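{- Let $n\in\mathbb{N}$. Every construction $C_n\subseteq G_n$ that is peaceful for $\theta=135^\circ$ satisfies $|C_n|\le 3n-2$.
   Context: $G_n=\{(x,y): x,y\in\{1,\dots,n\}\}$; a construction is a subset of $G_n$. Three distinct points $A,B,C$ form an angle of $\theta$ if one of the interior angles of the triangle $ABC$ equals $\theta$; a construction is peaceful for $\theta$ if no three of its points form an angle of $\theta$. -}

module Defs where

open import Data.Nat as ℕ using (ℕ; _≤_)
open import Data.Integer as ℤ using (ℤ; +_; _-_; _*_; _+_; _<_)
open import Data.Product using (_×_; _,_; proj₁; proj₂)
open import Data.Sum using (_⊎_)
open import Data.List using (List)
open import Data.List.Relation.Unary.All using (All)
open import Data.List.Relation.Unary.Unique.Propositional using (Unique)
open import Data.List.Membership.Propositional using (_∈_)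
open import Relation.Binary.PropositionalEquality using (_≡_; _≢_)
open import Relation.Nullary using (¬_)

Point : Set
Point = ℕ × ℕ

InGrid : ℕ → Point → Set
InGrid n (x , y) = (1 ≤ x × x ≤ n) × (1 ≤ y × y ≤ n)

dotAt : Point → Point → Point → ℤ
dotAt (ax , ay) (bx , by) (cx , cy) =
  ((+ ax - + bx) * (+ cx - + bx)) + ((+ ay - + by) * (+ cy - + by))

sqDist : Point → Point → ℤ
sqDist (ax , ay) (bx , by) =
  ((+ ax - + bx) * (+ ax - + bx)) + ((+ ay - + by) * (+ ay - + by))

-- The angle ∠ABC (at vertex B) equals 135°:
-- cos ∠ABC = -1/√2  ⇔  (A-B)·(C-B) < 0  and  2((A-B)·(C-B))² = |A-B|²|C-B|².
Angle135At : Point → Point → Point → Set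
Angle135At A B C =
  (dotAt A B C < + 0) ×
  (+ 2 * (dotAt A B C * dotAt A B C) ≡ sqDist A B * sqDist C B)

Forms135 : Point → Point → Point → Set
Forms135 A B C = Angle135At B A C ⊎ Angle135At A B C ⊎ Angle135At A C B

record Construction (n : ℕ) : Set where
  field
    points : List Point
    unique : Unique points
    inGrid : All (InGrid n) points

open Construction public

Peaceful135 : ∀ {n} → Construction n → Set
Peaceful135 Cn = ∀ {A B C} → A ∈ points Cn → B ∈ points Cn → C ∈ points Cn →
  A ≢ B → B ≢ C → A ≢ C → ¬ Forms135 A B C

{-# OPTIONS --safe #-}
-- If a point B had another point A of the construction to its east on the same row and
-- another point C to its north-west on the same antidiagonal, then ∠ABC = 135°.
-- Hence every point is either the eastmost point of its row (at most one per row, n in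
-- all) or, having a point east of it, has x < n and is the north-western end of its
-- antidiagonal x + y ∈ [2, 2n - 1] (at most 2n - 2 in all).
module Submission where

open import Defs
open import Data.Nat using (ℕ; _≤_; _*_; _∸_)
open import Data.List using (length)

open import Data.Nat using (zero; suc; _+_; _<_; _<?_; z≤n; s≤s)
import Data.Nat.Properties as ℕP
open import Data.Integer as ℤ using (ℤ; +_; +<+)
import Data.Integer.Properties as ℤP
import Data.Integer.Solver as ℤSolver
open import Data.Fin using (Fin; toℕ; fromℕ<)
import Data.Fin.Properties as FinP
open import Data.Product using (_×_; _,_; proj₁; proj₂)
import Data.Product.Properties as ×P
open import Data.Sum using (_⊎_; inj₁; inj₂; [_,_]′)
open import Data.List using (List; []; _∷_; filter; lookup)
open import Data.List.Relation.Unary.Any using (Any; any?)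
open import Data.List.Relation.Unary.AllPairs using (_∷_)
import Data.List.Relation.Unary.All as All
open import Data.List.Relation.Unary.Unique.Propositional using (Unique)
open import Data.List.Relation.Unary.Unique.Propositional.Properties using (filter⁺)
open import Data.List.Membership.Propositional using (_∈_; find; lose)
open import Data.List.Membership.Propositional.Properties using (∈-filter⁻; ∈-lookup)
open import Relation.Binary.PropositionalEquality
open import Relation.Binary.Definitions using (DecidableEquality; tri<; tri≈; tri>)
open import Relation.Nullary using (¬_; yes; no; contradiction)
open import Relation.Nullary.Decidable using (_×-dec_)
open import Relation.Unary using (Pred; Decidable)
open import Relation.Unary.Properties using (∁?)

X Y : Point → ℕ
X = proj₁
Y = proj₂

_≟ₚ_ : DecidableEquality Point
_≟ₚ_ = ×P.≡-dec ℕP._≟_ ℕP._≟_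

Vector : Set
Vector = ℤ × ℤ

_⊖_ : Point → Point → Vector
(ax , ay) ⊖ (bx , by) = + ax ℤ.- + bx , + ay ℤ.- + by

dot : Vector → Vector → ℤ
dot (a , b) (c , d) = a ℤ.* c ℤ.+ b ℤ.* d

-- Angle135At A B C unfolds to Angle135 (A ⊖ B) (C ⊖ B).
Angle135 : Vector → Vector → Set
Angle135 u v = dot u v ℤ.< + 0 × + 2 ℤ.* (dot u v ℤ.* dot u v) ≡ dot u u ℤ.* dot v v

Angle135-horizontal-antidiagonal : ∀ {p q} → + 0 ℤ.< p → q ℤ.< + 0 →
  Angle135 (p , + 0) (q , ℤ.- q)
Angle135-horizontal-antidiagonal {p} {q} 0<p q<0 = dot<0 , squares
  where
  open ℤSolver.+-*-Solver
  pq<0 : p ℤ.* q ℤ.< + 0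
  pq<0 = subst (p ℤ.* q ℤ.<_) (ℤP.*-zeroʳ p) (ℤP.*-monoˡ-<-pos p {{ℤ.positive 0<p}} q<0)
  dot<0 : p ℤ.* q ℤ.+ + 0 ℤ.< + 0
  dot<0 = subst (ℤ._< + 0) (sym (ℤP.+-identityʳ (p ℤ.* q))) pq<0
  squares : + 2 ℤ.* ((p ℤ.* q ℤ.+ + 0) ℤ.* (p ℤ.* q ℤ.+ + 0))
          ≡ (p ℤ.* p ℤ.+ + 0) ℤ.* (q ℤ.* q ℤ.+ ℤ.- q ℤ.* ℤ.- q)
  squares = solve 2 (λ p q → con (+ 2) :* ((p :* q :+ con (+ 0)) :* (p :* q :+ con (+ 0)))
                           := (p :* p :+ con (+ 0)) :* (q :* q :+ :- q :* :- q)) refl p q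

n<m⇒0<m-n : ∀ {m n} → n < m → + 0 ℤ.< + m ℤ.- + n
n<m⇒0<m-n {m} {n} n<m =
  subst (ℤ._< + m ℤ.- + n) (ℤP.+-inverseʳ (+ n)) (ℤP.+-monoˡ-< (ℤ.- + n) (+<+ n<m))

m<n⇒m-n<0 : ∀ {m n} → m < n → + m ℤ.- + n ℤ.< + 0
m<n⇒m-n<0 {m} {n} m<n =
  subst (+ m ℤ.- + n ℤ.<_) (ℤP.+-inverseʳ (+ n)) (ℤP.+-monoˡ-< (ℤ.- + n) (+<+ m<n))

x+y≡⇒Δy≡-Δx : ∀ {x₀ y₀ x₁ y₁} → x₁ + y₁ ≡ x₀ + y₀ →
  + y₁ ℤ.- + y₀ ≡ ℤ.- (+ x₁ ℤ.- + x₀)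
x+y≡⇒Δy≡-Δx {x₀} {y₀} {x₁} {y₁} x+y≡ = begin
  + y₁ ℤ.- + y₀
    ≡⟨ solve 4 (λ x₀ y₀ x₁ y₁ → y₁ :- y₀ := (x₁ :+ y₁) :- (x₀ :+ y₀) :- (x₁ :- x₀))
         refl (+ x₀) (+ y₀) (+ x₁) (+ y₁) ⟩
  + (x₁ + y₁) ℤ.- + (x₀ + y₀) ℤ.- (+ x₁ ℤ.- + x₀)
    ≡⟨ cong (ℤ._- (+ x₁ ℤ.- + x₀)) (ℤP.i≡j⇒i-j≡0 (cong +_ x+y≡)) ⟩
  + 0 ℤ.- (+ x₁ ℤ.- + x₀)
    ≡⟨ ℤP.+-identityˡ _ ⟩
  ℤ.- (+ x₁ ℤ.- + x₀) ∎
  where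
  open ≡-Reasoning
  open ℤSolver.+-*-Solver

East NorthWest : Point → Point → Set
East P Q = Y Q ≡ Y P × X P < X Q
NorthWest P Q = X Q + Y Q ≡ X P + Y P × X Q < X P

east? : ∀ P → Decidable (East P)
east? P Q = (Y Q ℕP.≟ Y P) ×-dec (X P <? X Q)

east-northWest⇒Angle135At : ∀ {A B C} → East B A → NorthWest B C → Angle135At A B C
east-northWest⇒Angle135At {xA , yA} {xB , yB} {xC , yC} (yA≡yB , xB<xA) (x+y≡ , xC<xB) =
  subst₂ (λ r s → Angle135 (+ xA ℤ.- + xB , r) (+ xC ℤ.- + xB , s))
    (sym (ℤP.i≡j⇒i-j≡0 (cong +_ yA≡yB))) (sym (x+y≡⇒Δy≡-Δx {xB} {yB} {xC} {yC} x+y≡))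
    (Angle135-horizontal-antidiagonal (n<m⇒0<m-n xB<xA) (m<n⇒m-n<0 xC<xB))

X>⇒≢ : ∀ {P Q} → X Q < X P → P ≢ Q
X>⇒≢ xQ<xP P≡Q = ℕP.<-irrefl (cong X (sym P≡Q)) xQ<xP

east-total : ∀ {P Q} → Y P ≡ Y Q → P ≢ Q → East P Q ⊎ East Q P
east-total {P} {Q} Y≡ P≢Q with ℕP.<-cmp (X P) (X Q)
... | tri< X<X _ _ = inj₁ (sym Y≡ , X<X)
... | tri≈ _ X≡X _ = contradiction (cong₂ _,_ X≡X Y≡) P≢Q
... | tri> _ _ X>X = inj₂ (Y≡ , X>X)

northWest-total : ∀ {P Q} → X P + Y P ≡ X Q + Y Q → P ≢ Q → NorthWest P Q ⊎ NorthWest Q P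
northWest-total {P} {Q} x+y≡ P≢Q with ℕP.<-cmp (X P) (X Q)
... | tri< X<X _ _ = inj₂ (x+y≡ , X<X)
... | tri≈ _ X≡X _ = contradiction (cong₂ _,_ X≡X Y≡Y) P≢Q
  where
  Y≡Y : Y P ≡ Y Q
  Y≡Y = ℕP.+-cancelˡ-≡ (X P) (Y P) (Y Q) (trans x+y≡ (cong (_+ Y Q) (sym X≡X)))
... | tri> _ _ X>X = inj₁ (sym x+y≡ , X>X)

ends-injective : ∀ {R : Point → Point → Set} (line : Point → ℕ) {xs P Q} →
  (∀ {P Q} → line P ≡ line Q → P ≢ Q → R P Q ⊎ R Q P) →
  P ∈ xs → Q ∈ xs → ¬ Any (R P) xs → ¬ Any (R Q) xs → line P ≡ line Q → P ≡ Q
ends-injective line {P = P} {Q} total P∈ Q∈ endP endQ line≡ with P ≟ₚ Q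
... | yes P≡Q = P≡Q
... | no P≢Q = [ (λ R[P,Q] → contradiction (lose Q∈ R[P,Q]) endP)
               , (λ R[Q,P] → contradiction (lose P∈ R[Q,P]) endQ) ]′ (total line≡ P≢Q)

lookup-injective : ∀ {A : Set} {xs : List A} → Unique xs → ∀ i j → lookup xs i ≡ lookup xs j → i ≡ j
lookup-injective (_ ∷ _) Fin.zero Fin.zero _ = refl
lookup-injective (x≢ ∷ _) Fin.zero (Fin.suc j) x≡ = contradiction x≡ (All.lookup x≢ (∈-lookup j))
lookup-injective (x≢ ∷ _) (Fin.suc i) Fin.zero ≡x = contradiction (sym ≡x) (All.lookup x≢ (∈-lookup i))
lookup-injective (_ ∷ u) (Fin.suc i) (Fin.suc j) eq = cong Fin.suc (lookup-injective u i j eq)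

injective-key⇒length≤ : ∀ {A : Set} {xs : List A} (key : A → ℕ) {lo hi} → Unique xs →
  (∀ {x} → x ∈ xs → lo ≤ key x × key x < hi) →
  (∀ {x y} → x ∈ xs → y ∈ xs → key x ≡ key y → x ≡ y) →
  length xs ≤ hi ∸ lo
injective-key⇒length≤ {xs = xs} key {lo} {hi} unique range injective =
  FinP.injective⇒≤ {f = slot} slot-injective
  where
  offset<width : ∀ i → key (lookup xs i) ∸ lo < hi ∸ lo
  offset<width i = ℕP.∸-monoˡ-< (proj₂ (range (∈-lookup i))) (proj₁ (range (∈-lookup i)))
  slot : Fin (length xs) → Fin (hi ∸ lo)
  slot i = fromℕ< (offset<width i)
  slot-injective : ∀ {i j} → slot i ≡ slot j → i ≡ j
  slot-injective {i} {j} slot≡ = lookup-injective unique i j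
    (injective (∈-lookup i) (∈-lookup j)
      (ℕP.∸-cancelʳ-≡ (proj₁ (range (∈-lookup i))) (proj₁ (range (∈-lookup j))) (begin
        key (lookup xs i) ∸ lo  ≡⟨ FinP.toℕ-fromℕ< (offset<width i) ⟨
        toℕ (slot i)            ≡⟨ cong toℕ slot≡ ⟩
        toℕ (slot j)            ≡⟨ FinP.toℕ-fromℕ< (offset<width j) ⟩
        key (lookup xs j) ∸ lo  ∎)))
    where open ≡-Reasoning

length-filter-∁ : ∀ {A : Set} {p} {P : Pred A p} (P? : Decidable P) xs →
  length (filter (∁? P?) xs) + length (filter P? xs) ≡ length xs
length-filter-∁ P? [] = refl
length-filter-∁ P? (x ∷ xs) with P? x
... | yes _ = trans (ℕP.+-suc _ _) (cong suc (length-filter-∁ P? xs))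
... | no _ = cong suc (length-filter-∁ P? xs)

n+[n+n∸2]≡3*n∸2 : ∀ n → n + (n + n ∸ 2) ≡ 3 * n ∸ 2
n+[n+n∸2]≡3*n∸2 zero = refl
n+[n+n∸2]≡3*n∸2 n@(suc _) = begin
  n + (n + n ∸ 2)  ≡⟨ ℕP.+-∸-assoc n (ℕP.+-mono-≤ (s≤s z≤n) (s≤s z≤n)) ⟨
  n + (n + n) ∸ 2  ≡⟨ cong (λ m → n + (n + m) ∸ 2) (ℕP.+-identityʳ n) ⟨
  3 * n ∸ 2        ∎
  where open ≡-Reasoning

module PeacefulConstruction {n} (Cn : Construction n) (peaceful : Peaceful135 Cn) where

  private
    xs : List Point
    xs = points Cn

  grid : ∀ {P} → P ∈ xs → InGrid n P
  grid = All.lookup (inGrid Cn)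

  HasEast : Pred Point _
  HasEast P = Any (East P) xs

  hasEast? : Decidable HasEast
  hasEast? P = any? (east? P) xs

  hasEast⇒northWestEnd : ∀ {B} → B ∈ xs → HasEast B → ¬ Any (NorthWest B) xs
  hasEast⇒northWestEnd B∈ hasEast hasNorthWest with find hasEast | find hasNorthWest
  ... | A , A∈ , B→A | C , C∈ , B→C =
    peaceful A∈ B∈ C∈ (X>⇒≢ (proj₂ B→A)) (X>⇒≢ (proj₂ B→C))
      (X>⇒≢ (ℕP.<-trans (proj₂ B→C) (proj₂ B→A)))
      (inj₂ (inj₁ (east-northWest⇒Angle135At B→A B→C)))

  eastEnds≤n : length (filter (∁? hasEast?) xs) ≤ n
  eastEnds≤n = injective-key⇒length≤ Y (filter⁺ (∁? hasEast?) (unique Cn)) range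
    (λ P∈ Q∈ → let (P∈xs , endP) = ∈-filter⁻ (∁? hasEast?) P∈
                   (Q∈xs , endQ) = ∈-filter⁻ (∁? hasEast?) Q∈
               in ends-injective Y east-total P∈xs Q∈xs endP endQ)
    where
    range : ∀ {P} → P ∈ filter (∁? hasEast?) xs → 1 ≤ Y P × Y P < suc n
    range P∈ = let (_ , (1≤y , y≤n)) = grid (proj₁ (∈-filter⁻ (∁? hasEast?) P∈)) in 1≤y , s≤s y≤n

  withEast≤2n∸2 : length (filter hasEast? xs) ≤ n + n ∸ 2
  withEast≤2n∸2 = injective-key⇒length≤ (λ P → X P + Y P) (filter⁺ hasEast? (unique Cn)) range
    (λ P∈ Q∈ → let (P∈xs , hasEastP) = ∈-filter⁻ hasEast? P∈
                   (Q∈xs , hasEastQ) = ∈-filter⁻ hasEast? Q∈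
               in ends-injective (λ P → X P + Y P) northWest-total P∈xs Q∈xs
                    (hasEast⇒northWestEnd P∈xs hasEastP) (hasEast⇒northWestEnd Q∈xs hasEastQ))
    where
    range : ∀ {P} → P ∈ filter hasEast? xs → 2 ≤ X P + Y P × X P + Y P < n + n
    range P∈ with ∈-filter⁻ hasEast? P∈
    ... | P∈xs , hasEast with grid P∈xs | find hasEast
    ... | (1≤x , _) , (1≤y , y≤n) | Q , Q∈xs , (_ , x<xQ) =
      ℕP.+-mono-≤ 1≤x 1≤y , ℕP.+-mono-<-≤ (ℕP.<-≤-trans x<xQ (proj₂ (proj₁ (grid Q∈xs)))) y≤n

theorem3 : (n : ℕ) (Cn : Construction n) → Peaceful135 Cn →
    length (points Cn) ≤ 3 * n ∸ 2
theorem3 n Cn peaceful = begin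
  length (points Cn)
    ≡⟨ length-filter-∁ hasEast? (points Cn) ⟨
  length (filter (∁? hasEast?) (points Cn)) + length (filter hasEast? (points Cn))
    ≤⟨ ℕP.+-mono-≤ eastEnds≤n withEast≤2n∸2 ⟩
  n + (n + n ∸ 2)
    ≡⟨ n+[n+n∸2]≡3*n∸2 n ⟩
  3 * n ∸ 2 ∎
  where
  open PeacefulConstruction Cn peaceful
  open ℕP.≤-Reasoning
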